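{- Let $G$ be a connected graph and let $u,v$ be distinct non-adjacent vertices of $G$. Let $w\notin V(G)$ be a new vertex and let $\hat G$ be the graph with $V(\hat G)=V(G)\cup\{w\}$ and $E(\hat G)=E(G)\cup\{(u,v),(v,w)\}$. If $G$ is single-headed then $\hat G$ is single-headed.
   Context: A directed 3-hypergraph $H=(V,F)$ consists of hyperarcs $a,b\to c$ (body $\{a,b\}$ of two distinct vertices, head $c$). The closure $cl_H(S)$ of $S\subseteq V$ is obtained by forward chaining: mark $S$; while some hyperarc $a,b\to c$ has $a,b$ marked and $c$ unmarked, mark $c$. $H$ represents $G=(V,E)$ if for all distinct $x,y$: $(x,y)\in E\Rightarrow cl_H(\{x,y\})=V$ and $(x,y)\notin E\Rightarrow cl_H(\{x,y\})=\{x,y\}$. The hydra number $h(G)$ is the minimum number of hyperarcs of a directed 3-hypergraph on $V$ representing $G$; $G$ is single-headed if $h(G)=|E(G)|$. -}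

module Defs where

open import Data.Nat using (ℕ; zero; suc; _≤_; _<ᵇ_)
open import Data.Fin using (Fin; zero; suc; toℕ; _≟_)
open import Data.Fin.Base using (Fin)
open import Data.Bool using (Bool; true; false; _∧_; _∨_)
open import Data.List using (List; length; filterᵇ; concatMap; map; allFin)
open import Data.List.Membership.Propositional using (_∈_)
open import Data.Product using (Σ; _×_; _,_)
open import Data.Sum using (_⊎_)
open import Relation.Nullary using (¬_)
open import Relation.Nullary.Decidable using (⌊_⌋)
open import Relation.Binary.PropositionalEquality using (_≡_)

-- A graph on vertex set Fin n is given by a Boolean adjacency function.
-- (Symmetry and irreflexivity are imposed as hypotheses where needed.)
Adj : ℕ → Set
Adj n = Fin n → Fin n → Bool

edgeCount : {n : ℕ} → Adj n → ℕ
edgeCount {n} adj =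
  length (filterᵇ (λ p → (toℕ (Data.Product.proj₁ p) <ᵇ toℕ (Data.Product.proj₂ p))
                          ∧ adj (Data.Product.proj₁ p) (Data.Product.proj₂ p))
                  (concatMap (λ x → map (λ y → (x , y)) (allFin n)) (allFin n)))

data Reach {n : ℕ} (adj : Adj n) : Fin n → Fin n → Set where
  here : ∀ {x} → Reach adj x x
  step : ∀ {x y z} → adj x y ≡ true → Reach adj y z → Reach adj x z

Connected : {n : ℕ} → Adj n → Set
Connected {n} adj = ∀ (x y : Fin n) → Reach adj x y

record Hyperarc (n : ℕ) : Set where
  constructor arc
  field
    tail₁ tail₂ head : Fin n
    distinct : ¬ (tail₁ ≡ tail₂)

Hypergraph : ℕ → Set
Hypergraph n = List (Hyperarc n)

data Cl {n : ℕ} (H : Hypergraph n) (x y : Fin n) : Fin n → Set where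
  inl  : Cl H x y x
  inr  : Cl H x y y
  fire : ∀ (e : Hyperarc n) → e ∈ H →
         Cl H x y (Hyperarc.tail₁ e) → Cl H x y (Hyperarc.tail₂ e) →
         Cl H x y (Hyperarc.head e)

Represents : {n : ℕ} → Hypergraph n → Adj n → Set
Represents {n} H adj = ∀ (x y : Fin n) → ¬ (x ≡ y) →
  (adj x y ≡ true → ∀ z → Cl H x y z) ×
  (adj x y ≡ false → ∀ z → Cl H x y z → (z ≡ x) ⊎ (z ≡ y))

-- h(G) = |E(G)|: some representing hypergraph has |E| hyperarcs, and
-- every representing hypergraph has at least |E| hyperarcs.
SingleHeaded : {n : ℕ} → Adj n → Set
SingleHeaded {n} adj =
  Σ (Hypergraph n) (λ H → Represents H adj × length H ≡ edgeCount adj)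
  × (∀ (H : Hypergraph n) → Represents H adj → edgeCount adj ≤ length H)

_==_ : {n : ℕ} → Fin n → Fin n → Bool
x == y = ⌊ x ≟ y ⌋

-- Ĝ: vertex set Fin (suc n); new vertex w = zero, old vertex x ↦ suc x;
-- E(Ĝ) = E(G) ∪ {uv, vw}.
hat : {n : ℕ} → Adj n → Fin n → Fin n → Adj (suc n)
hat adj u v zero    zero    = false
hat adj u v zero    (suc y) = y == v
hat adj u v (suc x) zero    = x == v
hat adj u v (suc x) (suc y) = adj x y ∨ ((x == u) ∧ (y == v)) ∨ ((x == v) ∧ (y == u))

module Submission where

open import Defs
open import Data.Nat using (ℕ; zero; suc; _+_; _≤_; _<ᵇ_; z≤n; s≤s)
open import Data.Nat.Properties
  using (+-0-commutativeMonoid; +-comm; +-mono-≤; ≤-refl; ≤-reflexive; module ≤-Reasoning)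
open import Data.Fin using (Fin; zero; suc; toℕ; _≟_)
import Data.Fin as Fin
open import Data.Fin.Properties using (suc-injective)
open import Data.Bool using (Bool; true; false; _∧_; _∨_)
open import Data.Bool.Properties using (∧-zeroʳ; ∨-identityʳ; ∨-comm)
open import Data.List using (List; []; _∷_; _++_; length; filterᵇ; concat; map; tabulate)
open import Data.List.Properties using (length-++; filter-++; map-tabulate; length-map)
open import Data.List.Membership.Propositional using (_∈_)
open import Data.List.Membership.Propositional.Properties using (∈-map⁺; ∈-map⁻)
open import Data.List.Relation.Unary.Any using (here; there)
open import Data.Product using (∃; _×_; _,_; proj₁; proj₂)
open import Data.Sum using (_⊎_; inj₁; inj₂; [_,_]′)
import Data.Sum as Sum
import Data.Product as Product
open import Function using (_∘_; id)
open import Relation.Nullary using (¬_; yes; no; contradiction)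
open import Relation.Nullary.Decidable using (T?)
open import Relation.Binary.PropositionalEquality
open import Algebra.Properties.CommutativeMonoid.Sum +-0-commutativeMonoid
  using (sum; sum-syntax; sum-cong-≗; sum-replicate-zero; ∑-distrib-+)

-- Lift a representation H of G with |E(G)| hyperarcs to Ĝ and add the hyperarcs u,v → w
-- and w,v → a, where a is a neighbour of v in G (G is connected). The closure of {u,v}
-- gets w, then a, and then all of V(G) as the closure of the G-edge {v,a}; the closure of
-- {w,v} gets a at once and then the same. The only new bodies, {u,v} and {w,v}, are edges
-- of Ĝ, so non-edges stay closed; hence h(Ĝ) ≤ |E(G)| + 2 = |E(Ĝ)|. The lower bound holds
-- for every graph with at least three vertices: the closure of an edge {x,y} must leave
-- {x,y}, which needs a hyperarc with body {x,y}, and each hyperarc has a single body.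

open Hyperarc

⟦_⟧ : Bool → ℕ
⟦ true ⟧  = 1
⟦ false ⟧ = 0

sum-mono-≤ : ∀ {n} {f g : Fin n → ℕ} → (∀ i → f i ≤ g i) → sum f ≤ sum g
sum-mono-≤ {zero}  f≤g = z≤n
sum-mono-≤ {suc n} f≤g = +-mono-≤ (f≤g zero) (sum-mono-≤ (f≤g ∘ suc))

length-filterᵇ-tabulate : ∀ {n} {A : Set} (p : A → Bool) (f : Fin n → A) →
  length (filterᵇ p (tabulate f)) ≡ ∑[ i < n ] ⟦ p (f i) ⟧
length-filterᵇ-tabulate {zero}  p f = refl
length-filterᵇ-tabulate {suc n} p f with p (f zero)
... | true  = cong suc (length-filterᵇ-tabulate p (f ∘ suc))
... | false = length-filterᵇ-tabulate p (f ∘ suc)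

length-filterᵇ-concat : ∀ {n} {A : Set} (p : A → Bool) (xss : Fin n → List A) →
  length (filterᵇ p (concat (tabulate xss))) ≡ ∑[ i < n ] length (filterᵇ p (xss i))
length-filterᵇ-concat {zero}  p xss = refl
length-filterᵇ-concat {suc n} p xss = begin
  length (filterᵇ p (xss zero ++ concat (tabulate (xss ∘ suc))))
    ≡⟨ cong length (filter-++ (T? ∘ p) (xss zero) _) ⟩
  length (filterᵇ p (xss zero) ++ filterᵇ p (concat (tabulate (xss ∘ suc))))
    ≡⟨ length-++ (filterᵇ p (xss zero)) ⟩
  length (filterᵇ p (xss zero)) + length (filterᵇ p (concat (tabulate (xss ∘ suc))))
    ≡⟨ cong (length (filterᵇ p (xss zero)) +_) (length-filterᵇ-concat p (xss ∘ suc)) ⟩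
  ∑[ i < suc n ] length (filterᵇ p (xss i)) ∎
  where open ≡-Reasoning

pairIndicator : ∀ {n} → Adj n → Fin n → Fin n → ℕ
pairIndicator r x y = ⟦ (toℕ x <ᵇ toℕ y) ∧ r x y ⟧

-- Over Fin (suc n) this unfolds definitionally into the row of zero, which precedes every
-- other vertex, plus the count on the remaining vertices.
pairCount : ∀ {n} → Adj n → ℕ
pairCount {n} r = ∑[ x < n ] ∑[ y < n ] pairIndicator r x y

edgeCount≡pairCount : ∀ {n} (adj : Adj n) → edgeCount adj ≡ pairCount adj
edgeCount≡pairCount {n} adj = begin
  edgeCount adj
    ≡⟨ cong (length ∘ filterᵇ p ∘ concat) (map-tabulate id row) ⟩
  length (filterᵇ p (concat (tabulate row)))
    ≡⟨ length-filterᵇ-concat p row ⟩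
  ∑[ x < n ] length (filterᵇ p (row x))
    ≡⟨ sum-cong-≗ (λ x → cong (length ∘ filterᵇ p) (map-tabulate id (x ,_))) ⟩
  ∑[ x < n ] length (filterᵇ p (tabulate (x ,_)))
    ≡⟨ sum-cong-≗ (λ x → length-filterᵇ-tabulate p (x ,_)) ⟩
  pairCount adj ∎
  where
  open ≡-Reasoning
  p : Fin n × Fin n → Bool
  p (x , y) = (toℕ x <ᵇ toℕ y) ∧ adj x y
  row : Fin n → List (Fin n × Fin n)
  row x = map (x ,_) (tabulate id)

_∪_ : ∀ {n} → Adj n → Adj n → Adj n
(r ∪ s) x y = r x y ∨ s x y

pairCount-cong : ∀ {n} {r s : Adj n} → (∀ x y → r x y ≡ s x y) → pairCount r ≡ pairCount s
pairCount-cong r≡s = sum-cong-≗ (λ x → sum-cong-≗ (λ y → cong (⟦_⟧ ∘ (_ ∧_)) (r≡s x y)))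

<ᵇ-irrefl : ∀ m → (m <ᵇ m) ≡ false
<ᵇ-irrefl zero    = refl
<ᵇ-irrefl (suc m) = <ᵇ-irrefl m

pairCount-mono : ∀ {n} {r s : Adj n} →
  (∀ x y → ¬ x ≡ y → r x y ≡ true → s x y ≡ true) → pairCount r ≤ pairCount s
pairCount-mono {r = r} {s} r⇒s = sum-mono-≤ (λ x → sum-mono-≤ (λ y → pointwise x y))
  where
  pointwise : ∀ x y → pairIndicator r x y ≤ pairIndicator s x y
  pointwise x y with toℕ x <ᵇ toℕ y in x<y | r x y in rxy
  ... | false | _     = z≤n
  ... | true  | false = z≤n
  ... | true  | true  = ≤-reflexive (cong ⟦_⟧ (sym (r⇒s x y x≢y rxy)))
    where
    x≢y : ¬ x ≡ y
    x≢y refl = contradiction (trans (sym x<y) (<ᵇ-irrefl (toℕ x))) λ ()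

pairCount-+ : ∀ {n} (r s : Adj n) → pairCount r + pairCount s ≡
  ∑[ x < n ] ∑[ y < n ] (pairIndicator r x y + pairIndicator s x y)
pairCount-+ {n} r s = sym (begin
  ∑[ x < n ] ∑[ y < n ] (pairIndicator r x y + pairIndicator s x y)
    ≡⟨ sum-cong-≗ {n} (λ x → ∑-distrib-+ (pairIndicator r x) (pairIndicator s x)) ⟩
  ∑[ x < n ] (∑[ y < n ] pairIndicator r x y + ∑[ y < n ] pairIndicator s x y)
    ≡⟨ ∑-distrib-+ (λ x → ∑[ y < n ] pairIndicator r x y) (λ x → ∑[ y < n ] pairIndicator s x y) ⟩
  pairCount r + pairCount s ∎)
  where open ≡-Reasoning

pairCount-∪-≤ : ∀ {n} (r s : Adj n) → pairCount (r ∪ s) ≤ pairCount r + pairCount s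
pairCount-∪-≤ r s = begin
  pairCount (r ∪ s)
    ≤⟨ sum-mono-≤ (λ x → sum-mono-≤ (λ y → pointwise (toℕ x <ᵇ toℕ y) (r x y) (s x y))) ⟩
  _ ≡⟨ pairCount-+ r s ⟨
  pairCount r + pairCount s ∎
  where
  open ≤-Reasoning
  pointwise : ∀ l a b → ⟦ l ∧ (a ∨ b) ⟧ ≤ ⟦ l ∧ a ⟧ + ⟦ l ∧ b ⟧
  pointwise false a     b = z≤n
  pointwise true  true  b = s≤s z≤n
  pointwise true  false b = ≤-refl

pairCount-∪-disjoint : ∀ {n} (r s : Adj n) → (∀ x y → r x y ≡ true → s x y ≡ false) →
  pairCount (r ∪ s) ≡ pairCount r + pairCount s
pairCount-∪-disjoint r s disjoint = begin
  pairCount (r ∪ s)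
    ≡⟨ sum-cong-≗ (λ x → sum-cong-≗ (λ y → pointwise (toℕ x <ᵇ toℕ y) (disjoint x y))) ⟩
  _ ≡⟨ pairCount-+ r s ⟨
  pairCount r + pairCount s ∎
  where
  open ≡-Reasoning
  pointwise : ∀ {a b} l → (a ≡ true → b ≡ false) → ⟦ l ∧ (a ∨ b) ⟧ ≡ ⟦ l ∧ a ⟧ + ⟦ l ∧ b ⟧
  pointwise {false} false _ = refl
  pointwise {true}  false _ = refl
  pointwise {false} true  _ = refl
  pointwise {true}  true  a⇒¬b rewrite a⇒¬b refl = refl

pairCount-false : ∀ {n} → pairCount {n} (λ _ _ → false) ≡ 0
pairCount-false {n} = begin
  pairCount {n} (λ _ _ → false)
    ≡⟨ sum-cong-≗ {n} (λ x → sum-cong-≗ {n} (λ y → cong ⟦_⟧ (∧-zeroʳ (toℕ x <ᵇ toℕ y)))) ⟩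
  ∑[ x < n ] ∑[ y < n ] 0
    ≡⟨ sum-cong-≗ {n} (λ _ → sum-replicate-zero n) ⟩
  ∑[ x < n ] 0
    ≡⟨ sum-replicate-zero n ⟩
  0 ∎
  where open ≡-Reasoning

-- Written exactly like the edge uv in `hat`, so that `hat adj u v` restricted to the old
-- vertices is definitionally `adj ∪ pair u v`.
pair : ∀ {n} → Fin n → Fin n → Adj n
pair p q x y = ((x == p) ∧ (y == q)) ∨ ((x == q) ∧ (y == p))

==-refl : ∀ {n} (x : Fin n) → (x == x) ≡ true
==-refl x with x ≟ x
... | yes _  = refl
... | no x≢x = contradiction refl x≢x

==-sound : ∀ {n} {x y : Fin n} → (x == y) ≡ true → x ≡ y
==-sound {x = x} {y} x==y with x ≟ y
... | yes x≡y = x≡y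

==-false⇒≢ : ∀ {n} {x y : Fin n} → (x == y) ≡ false → ¬ x ≡ y
==-false⇒≢ {x = x} x==x refl = contradiction (trans (sym (==-refl x)) x==x) λ ()

suc-== : ∀ {n} (x y : Fin n) → (Fin.suc x == suc y) ≡ (x == y)
suc-== x y with x ≟ y
... | yes _ = refl
... | no _  = refl

∑-== : ∀ {n} (q : Fin n) → ∑[ y < n ] ⟦ y == q ⟧ ≡ 1
∑-== {suc n} zero    = cong suc (sum-replicate-zero n)
∑-== {suc n} (suc q) = trans (sum-cong-≗ {n} (λ y → cong ⟦_⟧ (suc-== y q))) (∑-== q)

pair-comm : ∀ {n} (p q x y : Fin n) → pair p q x y ≡ pair q p x y
pair-comm p q x y = ∨-comm ((x == p) ∧ (y == q)) ((x == q) ∧ (y == p))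

pairCount-pair : ∀ {n} (p q : Fin n) → ¬ p ≡ q → pairCount (pair p q) ≡ 1
pairCount-pair zero    zero    p≢q = contradiction refl p≢q
pairCount-pair {suc n} zero (suc q) _ = cong₂ _+_
  (trans (sum-cong-≗ {n} (λ y → cong ⟦_⟧ (trans (∨-identityʳ _) (suc-== y q)))) (∑-== q))
  (trans (pairCount-cong (λ x y → ∧-zeroʳ (Fin.suc x == suc q))) (pairCount-false {n}))
pairCount-pair (suc p) zero    p≢q =
  trans (pairCount-cong (pair-comm (suc p) zero)) (pairCount-pair zero (suc p) (p≢q ∘ sym))
pairCount-pair {suc n} (suc p) (suc q) p≢q = cong₂ _+_
  (sum-replicate-zero n)
  (trans (pairCount-cong pair-suc) (pairCount-pair p q (p≢q ∘ cong suc)))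
  where
  pair-suc : ∀ x y → pair (suc p) (suc q) (suc x) (suc y) ≡ pair p q x y
  pair-suc x y rewrite suc-== x p | suc-== x q | suc-== y p | suc-== y q = refl

Joins : ∀ {n} → Fin n → Fin n → Fin n → Fin n → Set
Joins p q x y = (p ≡ x × q ≡ y) ⊎ (p ≡ y × q ≡ x)

pair-complete : ∀ {n} {p q x y : Fin n} → Joins p q x y → pair p q x y ≡ true
pair-complete {p = p} {q} (inj₁ (refl , refl)) rewrite ==-refl p | ==-refl q = refl
pair-complete {p = p} {q} (inj₂ (refl , refl)) rewrite ==-refl p | ==-refl q =
  ∨-comm ((q == p) ∧ (p == q)) true

pair-sound : ∀ {n} {p q x y : Fin n} → pair p q x y ≡ true → Joins p q x y
pair-sound {p = p} {q} {x} {y} pxy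
  with x == p in x≡p | y == q in y≡q | x == q in x≡q | y == p in y≡p
... | true  | true  | _    | _    = inj₁ (sym (==-sound x≡p) , sym (==-sound y≡q))
... | true  | false | true | true = inj₂ (sym (==-sound y≡p) , sym (==-sound x≡q))
... | false | _     | true | true = inj₂ (sym (==-sound y≡p) , sym (==-sound x≡q))

Cl-swap : ∀ {n} {H : Hypergraph n} {x y z} → Cl H x y z → Cl H y x z
Cl-swap inl = inr
Cl-swap inr = inl
Cl-swap (fire e e∈H c₁ c₂) = fire e e∈H (Cl-swap c₁) (Cl-swap c₂)

Cl-fire : ∀ {n} {H : Hypergraph n} {x y} {e} → e ∈ H → Joins (tail₁ e) (tail₂ e) x y →
  Cl H x y (head e)
Cl-fire {e = e} e∈H (inj₁ (refl , refl)) = fire e e∈H inl inr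
Cl-fire {e = e} e∈H (inj₂ (refl , refl)) = fire e e∈H inr inl

Cl-⊆-ends : ∀ {n} {H : Hypergraph n} {x y} →
  (∀ e → e ∈ H → Joins (tail₁ e) (tail₂ e) x y → head e ≡ x ⊎ head e ≡ y) →
  ∀ {z} → Cl H x y z → z ≡ x ⊎ z ≡ y
Cl-⊆-ends bodies inl = inj₁ refl
Cl-⊆-ends bodies inr = inj₂ refl
Cl-⊆-ends bodies (fire e e∈H c₁ c₂) with Cl-⊆-ends bodies c₁ | Cl-⊆-ends bodies c₂
... | inj₁ t₁≡x | inj₁ t₂≡x = contradiction (trans t₁≡x (sym t₂≡x)) (distinct e)
... | inj₂ t₁≡y | inj₂ t₂≡y = contradiction (trans t₁≡y (sym t₂≡y)) (distinct e)
... | inj₁ t₁≡x | inj₂ t₂≡y = bodies e e∈H (inj₁ (t₁≡x , t₂≡y))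
... | inj₂ t₁≡y | inj₁ t₂≡x = bodies e e∈H (inj₂ (t₁≡y , t₂≡x))

ThirdVertex : ℕ → Set
ThirdVertex n = ∀ (x y : Fin n) → ∃ λ z → ¬ z ≡ x × ¬ z ≡ y

covers : ∀ {n} → Hypergraph n → Adj n
covers []      = λ _ _ → false
covers (e ∷ H) = pair (tail₁ e) (tail₂ e) ∪ covers H

covers-∈ : ∀ {n} {H : Hypergraph n} {e x y} → e ∈ H → Joins (tail₁ e) (tail₂ e) x y →
  covers H x y ≡ true
covers-∈ (here refl) j rewrite pair-complete j = refl
covers-∈ {H = e ∷ _} {x = x} {y} (there e∈H) j
  rewrite covers-∈ e∈H j = ∨-comm (pair (tail₁ e) (tail₂ e) x y) true

pairCount-covers : ∀ {n} (H : Hypergraph n) → pairCount (covers H) ≤ length H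
pairCount-covers {n} [] = ≤-reflexive (pairCount-false {n})
pairCount-covers (e ∷ H) = begin
  pairCount (pair (tail₁ e) (tail₂ e) ∪ covers H)
    ≤⟨ pairCount-∪-≤ (pair (tail₁ e) (tail₂ e)) (covers H) ⟩
  pairCount (pair (tail₁ e) (tail₂ e)) + pairCount (covers H)
    ≡⟨ cong (_+ pairCount (covers H)) (pairCount-pair (tail₁ e) (tail₂ e) (distinct e)) ⟩
  suc (pairCount (covers H))
    ≤⟨ s≤s (pairCount-covers H) ⟩
  suc (length H) ∎
  where open ≤-Reasoning

uncovered-⊆-ends : ∀ {n} {H : Hypergraph n} {x y} → covers H x y ≡ false →
  ∀ {z} → Cl H x y z → z ≡ x ⊎ z ≡ y
uncovered-⊆-ends uncovered =
  Cl-⊆-ends λ e e∈H j → contradiction (trans (sym (covers-∈ e∈H j)) uncovered) λ ()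

edge-covered : ∀ {n} {H : Hypergraph n} {adj : Adj n} → Represents H adj → ThirdVertex n →
  ∀ x y → ¬ x ≡ y → adj x y ≡ true → covers H x y ≡ true
edge-covered {H = H} H-rep third x y x≢y xy∈E with covers H x y in xy-covered
... | true  = refl
... | false with third x y
...   | z , z≢x , z≢y =
  contradiction (uncovered-⊆-ends xy-covered (proj₁ (H-rep x y x≢y) xy∈E z)) [ z≢x , z≢y ]′

edgeCount≤length : ∀ {n} {H : Hypergraph n} {adj : Adj n} →
  ThirdVertex n → Represents H adj → edgeCount adj ≤ length H
edgeCount≤length {H = H} {adj} third H-rep = begin
  edgeCount adj        ≡⟨ edgeCount≡pairCount adj ⟩
  pairCount adj        ≤⟨ pairCount-mono (edge-covered H-rep third) ⟩
  pairCount (covers H) ≤⟨ pairCount-covers H ⟩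
  length H             ∎
  where open ≤-Reasoning

RepresentsAt : ∀ {n} → Hypergraph n → Adj n → Fin n → Fin n → Set
RepresentsAt H adj x y =
  (adj x y ≡ true → ∀ z → Cl H x y z) × (adj x y ≡ false → ∀ z → Cl H x y z → z ≡ x ⊎ z ≡ y)

RepresentsAt-swap : ∀ {n} {H : Hypergraph n} {adj : Adj n} {x y} → adj x y ≡ adj y x →
  RepresentsAt H adj y x → RepresentsAt H adj x y
RepresentsAt-swap xy≡yx (spans , bounded) =
  (λ xy∈E z → Cl-swap (spans (trans (sym xy≡yx) xy∈E) z)) ,
  (λ xy∉E z → Sum.swap ∘ bounded (trans (sym xy≡yx) xy∉E) z ∘ Cl-swap)

liftArc : ∀ {n} → Hyperarc n → Hyperarc (suc n)
liftArc e = arc (suc (tail₁ e)) (suc (tail₂ e)) (suc (head e)) (distinct e ∘ suc-injective)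

Cl-lift : ∀ {n} {H : Hypergraph n} {H′ : Hypergraph (suc n)} {X Y} →
  (∀ {e} → e ∈ H → liftArc e ∈ H′) →
  ∀ {x y z} → Cl H x y z → Cl H′ X Y (suc x) → Cl H′ X Y (suc y) → Cl H′ X Y (suc z)
Cl-lift lift∈ inl cx cy = cx
Cl-lift lift∈ inr cx cy = cy
Cl-lift lift∈ (fire e e∈H c₁ c₂) cx cy =
  fire (liftArc e) (lift∈ e∈H) (Cl-lift lift∈ c₁ cx cy) (Cl-lift lift∈ c₂ cx cy)

Joins-suc⁻ : ∀ {n} {p q x y : Fin n} → Joins (suc p) (suc q) (suc x) (suc y) → Joins p q x y
Joins-suc⁻ =
  Sum.map (Product.map suc-injective suc-injective) (Product.map suc-injective suc-injective)

module Extension {n} (adj : Adj n) (H : Hypergraph n) (H-rep : Represents H adj)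
  (u v a : Fin n) (u≢v : ¬ u ≡ v) (va∈E : adj v a ≡ true) (v≢a : ¬ v ≡ a) where

  uv→w : Hyperarc (suc n)
  uv→w = arc (suc u) (suc v) zero (u≢v ∘ suc-injective)

  wv→a : Hyperarc (suc n)
  wv→a = arc zero (suc v) (suc a) λ ()

  Ĥ : Hypergraph (suc n)
  Ĥ = uv→w ∷ wv→a ∷ map liftArc H

  length-Ĥ : length Ĥ ≡ suc (suc (length H))
  length-Ĥ = cong (λ k → suc (suc k)) (length-map liftArc H)

  lift∈Ĥ : ∀ {e} → e ∈ H → liftArc e ∈ Ĥ
  lift∈Ĥ = there ∘ there ∘ ∈-map⁺ liftArc

  spans-from-w-v : ∀ {X Y} → Cl Ĥ X Y zero → Cl Ĥ X Y (suc v) → ∀ z → Cl Ĥ X Y z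
  spans-from-w-v w∈ v∈ zero    = w∈
  spans-from-w-v w∈ v∈ (suc z) =
    Cl-lift lift∈Ĥ (proj₁ (H-rep v a v≢a) va∈E z) v∈ (fire wv→a (there (here refl)) w∈ v∈)

  spans-u-v : ∀ z → Cl Ĥ (suc u) (suc v) z
  spans-u-v = spans-from-w-v (fire uv→w (here refl) inl inr) inr

  spans-old-edge : ∀ {x y} → ¬ x ≡ y → adj x y ≡ true → ∀ z → Cl Ĥ (suc x) (suc y) z
  spans-old-edge x≢y xy∈E zero    = fire uv→w (here refl) (spans-old-edge x≢y xy∈E (suc u))
                                                           (spans-old-edge x≢y xy∈E (suc v))
  spans-old-edge x≢y xy∈E (suc z) = Cl-lift lift∈Ĥ (proj₁ (H-rep _ _ x≢y) xy∈E z) inl inr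

  bounded-new-nonedge : ∀ {y} → ¬ y ≡ v → ∀ {z} → Cl Ĥ zero (suc y) z → z ≡ zero ⊎ z ≡ suc y
  bounded-new-nonedge {y} y≢v = Cl-⊆-ends bodies
    where
    bodies : ∀ e → e ∈ Ĥ → Joins (tail₁ e) (tail₂ e) zero (suc y) →
      head e ≡ zero ⊎ head e ≡ suc y
    bodies _ (here refl)         (inj₁ (() , _))
    bodies _ (here refl)         (inj₂ (_ , ()))
    bodies _ (there (here refl)) (inj₁ (_ , v≡y)) = contradiction (sym (suc-injective v≡y)) y≢v
    bodies _ (there (there e∈)) j with ∈-map⁻ liftArc e∈
    bodies _ (there (there e∈)) (inj₁ (() , _)) | _ , _ , refl
    bodies _ (there (there e∈)) (inj₂ (_ , ())) | _ , _ , refl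

  bounded-old-nonedge : ∀ {x y} → ¬ x ≡ y → adj x y ≡ false → pair u v x y ≡ false →
    ∀ {z} → Cl Ĥ (suc x) (suc y) z → z ≡ suc x ⊎ z ≡ suc y
  bounded-old-nonedge {x} {y} x≢y xy∉E xy≢uv = Cl-⊆-ends bodies
    where
    bodies : ∀ e → e ∈ Ĥ → Joins (tail₁ e) (tail₂ e) (suc x) (suc y) →
      head e ≡ suc x ⊎ head e ≡ suc y
    bodies _ (here refl) j = contradiction (trans (sym (pair-complete (Joins-suc⁻ j))) xy≢uv) λ ()
    bodies _ (there (here refl)) (inj₁ (() , _))
    bodies _ (there (here refl)) (inj₂ (() , _))
    bodies _ (there (there e∈)) j with ∈-map⁻ liftArc e∈
    ... | f , f∈H , refl = Sum.map (cong suc) (cong suc)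
      (proj₂ (H-rep x y x≢y) xy∉E (head f) (Cl-fire f∈H (Joins-suc⁻ j)))

  represents : Represents Ĥ (hat adj u v)
  represents zero    zero    w≢w = contradiction refl w≢w
  represents zero    (suc y) _   = new-edge , new-nonedge
    where
    new-edge : (y == v) ≡ true → ∀ z → Cl Ĥ zero (suc y) z
    new-edge y==v rewrite ==-sound y==v = spans-from-w-v inl inr
    new-nonedge : (y == v) ≡ false → ∀ z → Cl Ĥ zero (suc y) z → z ≡ zero ⊎ z ≡ suc y
    new-nonedge y≠v _ = bounded-new-nonedge (==-false⇒≢ y≠v)
  represents (suc x) zero    x≢w =
    RepresentsAt-swap {adj = hat adj u v} refl (represents zero (suc x) (x≢w ∘ sym))
  represents (suc x) (suc y) sx≢sy = old-edge , old-nonedge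
    where
    x≢y : ¬ x ≡ y
    x≢y = sx≢sy ∘ cong suc
    old-edge : (adj x y ∨ pair u v x y) ≡ true → ∀ z → Cl Ĥ (suc x) (suc y) z
    old-edge xy∈Ê with adj x y in xy∈E
    ... | true  = spans-old-edge x≢y xy∈E
    ... | false with pair-sound {p = u} {v} {x} {y} xy∈Ê
    ...   | inj₁ (refl , refl) = spans-u-v
    ...   | inj₂ (refl , refl) = Cl-swap ∘ spans-u-v
    old-nonedge : (adj x y ∨ pair u v x y) ≡ false →
      ∀ z → Cl Ĥ (suc x) (suc y) z → z ≡ suc x ⊎ z ≡ suc y
    old-nonedge xy∉Ê with adj x y in xy∉E
    ... | false = λ _ → bounded-old-nonedge x≢y xy∉E xy∉Ê

edgeCount-hat : ∀ {n} (adj : Adj n) → (∀ x y → adj x y ≡ adj y x) →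
  (u v : Fin n) → ¬ u ≡ v → adj u v ≡ false →
  edgeCount (hat adj u v) ≡ suc (suc (edgeCount adj))
edgeCount-hat {n} adj adj-sym u v u≢v uv∉E = begin
  edgeCount (hat adj u v)
    ≡⟨ edgeCount≡pairCount (hat adj u v) ⟩
  ∑[ y < n ] ⟦ y == v ⟧ + pairCount (adj ∪ pair u v)
    ≡⟨ cong₂ _+_ (∑-== v) (pairCount-∪-disjoint adj (pair u v) disjoint) ⟩
  1 + (pairCount adj + pairCount (pair u v))
    ≡⟨ cong (λ k → 1 + (pairCount adj + k)) (pairCount-pair u v u≢v) ⟩
  1 + (pairCount adj + 1)
    ≡⟨ cong suc (+-comm (pairCount adj) 1) ⟩
  suc (suc (pairCount adj))
    ≡⟨ cong (λ k → suc (suc k)) (edgeCount≡pairCount adj) ⟨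
  suc (suc (edgeCount adj)) ∎
  where
  open ≡-Reasoning
  disjoint : ∀ x y → adj x y ≡ true → pair u v x y ≡ false
  disjoint x y xy∈E with pair u v x y in xy≡uv
  ... | false = refl
  ... | true with pair-sound {p = u} {v} {x} {y} xy≡uv
  ...   | inj₁ (refl , refl) = contradiction (trans (sym xy∈E) uv∉E) λ ()
  ...   | inj₂ (refl , refl) = contradiction (trans (sym xy∈E) (trans (adj-sym v u) uv∉E)) λ ()

three-distinct⇒ThirdVertex : ∀ {m} (p q r : Fin m) → ¬ p ≡ q → ¬ q ≡ r → ¬ p ≡ r → ThirdVertex m
three-distinct⇒ThirdVertex p q r p≢q q≢r p≢r x y with p ≟ x | p ≟ y
... | no p≢x    | no p≢y = p , p≢x , p≢y
... | yes refl  | _ with q ≟ y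
...   | no q≢y   = q , p≢q ∘ sym , q≢y
...   | yes refl = r , p≢r ∘ sym , q≢r ∘ sym
three-distinct⇒ThirdVertex p q r p≢q q≢r p≢r x y | no p≢x | yes refl with q ≟ x
...   | no q≢x   = q , q≢x , p≢q ∘ sym
...   | yes refl = r , q≢r ∘ sym , p≢r ∘ sym

neighbour : ∀ {n} {adj : Adj n} {x y} → ¬ x ≡ y → Reach adj x y → ∃ λ a → adj x a ≡ true
neighbour x≢x here         = contradiction refl x≢x
neighbour _   (step xa∈E _) = _ , xa∈E

adjacent⇒≢ : ∀ {n} {adj : Adj n} → (∀ x → adj x x ≡ false) → ∀ {x y} → adj x y ≡ true → ¬ x ≡ y
adjacent⇒≢ irrefl {x} xy∈E refl = contradiction (trans (sym xy∈E) (irrefl x)) λ ()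

proposition3p6 : (n : ℕ) (adj : Adj n)
    → (∀ x y → adj x y ≡ adj y x)
    → (∀ x → adj x x ≡ false)
    → Connected adj
    → (u v : Fin n) → ¬ (u ≡ v) → adj u v ≡ false
    → SingleHeaded adj
    → SingleHeaded (hat adj u v)
proposition3p6 n adj adj-sym adj-irrefl connected u v u≢v uv∉E ((H , H-rep , |H|≡|E|) , _)
  with neighbour (u≢v ∘ sym) (connected v u)
... | a , va∈E = (Ĥ , represents , |Ĥ|≡|Ê|) , λ _ → edgeCount≤length third-vertex
  where
  open Extension adj H H-rep u v a u≢v va∈E (adjacent⇒≢ {adj = adj} adj-irrefl va∈E)
  |Ĥ|≡|Ê| : length Ĥ ≡ edgeCount (hat adj u v)
  |Ĥ|≡|Ê| = begin
    length Ĥ                  ≡⟨ length-Ĥ ⟩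
    suc (suc (length H))      ≡⟨ cong (λ k → suc (suc k)) |H|≡|E| ⟩
    suc (suc (edgeCount adj)) ≡⟨ edgeCount-hat adj adj-sym u v u≢v uv∉E ⟨
    edgeCount (hat adj u v)   ∎
    where open ≡-Reasoning
  third-vertex : ThirdVertex (suc n)
  third-vertex = three-distinct⇒ThirdVertex zero (suc u) (suc v) (λ ()) (u≢v ∘ suc-injective) (λ ())
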